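{- Let $n\ge 3$, let $1\le i_0<j_0\le n$ with $j_0\ge i_0+2$, let $\alpha=\varepsilon_{i_0}-\varepsilon_{j_0}$, $s=s_\alpha$, and let $w\in S_n$ satisfy $w(i_0)>w(j_0)$ and $w(j_0)<w(k)<w(i_0)$ for all $k$ with $i_0<k<j_0$; put $w'=ws$. Let $\beta$ be a negative root sharing the column of $\alpha$. If $\beta$ is bad, then $(\beta_1,\beta_2)\mapsto(s(\beta_1),\beta_2)$ is a bijection from $\mathfrak{A}_\beta$ onto the set of elements $(\beta_1,\beta_2)\in\mathfrak{A}_{s(\beta)}$ such that $s(\beta_1)$ is a bad (negative) root. Moreover, if $\beta$ is not bad and $(\beta_1,\beta_2)\in\mathfrak{A}_{s(\beta)}$, then $s(\beta_1)$ is not a bad root.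
   Context: $S_n$ acts on $\mathbb{Z}^n$ by $w(\varepsilon_i)=\varepsilon_{w(i)}$. For $l\ne m$, $\alpha_{lm}=\varepsilon_l-\varepsilon_m$, positive if $l<m$, negative if $l>m$; $w(\alpha_{lm})=\alpha_{w(l)w(m)}$. $s=s_\alpha$ is the transposition $(i_0\,j_0)$, $s(\alpha_{lm})=\alpha_{s(l)s(m)}$. $\delta_P$ is $1$ if $P$ holds, else $0$. For a negative root $\beta=\alpha_{lm}$: it shares the row of $\alpha$ if $l=i_0$, the column of $\alpha$ if $m=j_0$, the row of $-\alpha$ if $l=j_0$, the column of $-\alpha$ if $m=i_0$. A negative root $\beta$ is bad if it shares the row or column of $\alpha$ and $\delta_{w(\beta)<0}=\delta_{w'(\beta)<0}$ (only negative roots can be bad). Define $\kappa'_\beta=\delta_{w(\beta)<0}$ if $l=i_0$ or $m\in\{i_0,j_0\}$, and $\kappa'_\beta=\delta_{w'(\beta)<0}$ otherwise. $\mathfrak{D}_\beta=\{(\alpha_{km},\alpha_{lk}):m<k<l\}$, and for any negative root $\gamma$, $\mathfrak{A}_\gamma=\{(\gamma_1,\gamma_2)\in\mathfrak{D}_\gamma:\kappa'_\gamma=\kappa'_{\gamma_1}+\kappa'_{\gamma_2}\}$. -}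

module Defs where

open import Data.Nat using (ℕ; _+_)
open import Data.Bool using (Bool; true; false; if_then_else_; _∨_)
open import Data.Fin using (Fin; _<_; _<?_; _≟_)
open import Data.Fin.Permutation using (Permutation′; _⟨$⟩ʳ_; transpose)
open import Data.Product using (_×_; _,_; proj₁; proj₂; ∃-syntax)
open import Data.Sum using (_⊎_)
open import Relation.Nullary using (does)
open import Relation.Binary.PropositionalEquality using (_≡_)

δ : Bool → ℕ
δ true  = 1
δ false = 0

-- A root α_{lm} = ε_l - ε_m is represented by the pair (l , m) (indices 0-based in Fin n).
Root : ℕ → Set
Root n = Fin n × Fin n

IsNeg : ∀ {n} → Root n → Set
IsNeg (l , m) = m < l

-- Everything below depends on i0, j0 (α = α_{i0 j0}, s = s_α) and w ∈ S_n; w' = w s.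
module Setup {n : ℕ} (i0 j0 : Fin n) (w : Permutation′ n) where

  s : Fin n → Fin n
  s x = transpose i0 j0 ⟨$⟩ʳ x

  sR : Root n → Root n
  sR (l , m) = (s l , s m)

  w′ : Fin n → Fin n
  w′ x = w ⟨$⟩ʳ (s x)

  -- δ_{w(β)<0} : w(α_{lm}) = α_{w(l) w(m)} is negative iff w(l) > w(m)
  wNeg : Root n → Bool
  wNeg (l , m) = does ((w ⟨$⟩ʳ m) <? (w ⟨$⟩ʳ l))

  w′Neg : Root n → Bool
  w′Neg (l , m) = does (w′ m <? w′ l)

  SharesRowα : Root n → Set
  SharesRowα (l , m) = l ≡ i0

  SharesColα : Root n → Set
  SharesColα (l , m) = m ≡ j0

  Bad : Root n → Set
  Bad β = IsNeg β × (SharesRowα β ⊎ SharesColα β) × (wNeg β ≡ w′Neg β)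

  κ′ : Root n → ℕ
  κ′ (l , m) =
    if does (l ≟ i0) ∨ does (m ≟ i0) ∨ does (m ≟ j0)
    then δ (wNeg (l , m))
    else δ (w′Neg (l , m))

  InD : Root n → Root n × Root n → Set
  InD (l , m) (γ₁ , γ₂) = ∃[ k ] (m < k × k < l × γ₁ ≡ (k , m) × γ₂ ≡ (l , k))

  InA : Root n → Root n × Root n → Set
  InA γ p = InD γ p × (κ′ γ ≡ κ′ (proj₁ p) + κ′ (proj₂ p))

  φ : Root n × Root n → Root n × Root n
  φ (β₁ , β₂) = (sR β₁ , β₂)

{-# OPTIONS --safe #-}
-- Write a = w(j0) < b = w(i0) and, for β = α_{l j0}, x = w(l), y = w(k). On every root
-- that occurs, κ′ coincides with δ_{w(·)<0}, and w′(γ) < 0 iff w(s γ) < 0. Hence β is bad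
-- iff x lies outside the interval (a, b); the pair indexed by k lies in 𝔄_β (resp. 𝔄_{sβ})
-- iff δ[a<x] = δ[a<y] + δ[y<x] (resp. the same with b); and s(β₁) is bad iff j0 < k and
-- y lies outside (a, b). The theorem thus reduces to two facts about points of a line.
module Submission where

open import Defs
open import Data.Nat using (ℕ; _≤_; _+_)
open import Data.Fin using (Fin; toℕ; _<_; _<?_; _≟_)
open import Data.Fin.Permutation using (Permutation′; _⟨$⟩ʳ_)
open import Data.Product using (_×_; _,_; proj₁; proj₂; ∃-syntax)
open import Relation.Nullary using (¬_)
open import Relation.Binary.PropositionalEquality using (_≡_)

open import Data.Bool using (true; false)
open import Data.Bool.Properties using (∨-zeroʳ)
open import Data.Fin.Properties using (<-trans; <-irrefl; <⇒≢; ≤∧≢⇒<)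
import Data.Nat.Properties as ℕ
open import Data.Sum using (_⊎_; inj₁; inj₂)
open import Function using (_∘_; _⇔_; mk⇔; Equivalence; Injection)
open import Function.Construct.Identity using (⇔-id)
open import Function.Properties.Inverse using (↔⇒↣)
open import Relation.Nullary using (Dec; yes; no; does; proof; contradiction)
open import Relation.Nullary.Reflects using (ofʸ; ofⁿ)
open import Relation.Nullary.Decidable using (dec-true; dec-false)
open import Relation.Binary.PropositionalEquality
  using (_≢_; refl; sym; trans; cong; cong₂; subst; subst₂; ≢-sym)

open Equivalence using (to; from)

≮∧≢⇒> : ∀ {n} {u v : Fin n} → ¬ u < v → v ≢ u → v < u
≮∧≢⇒> u≮v v≢u = ≤∧≢⇒< (ℕ.≮⇒≥ u≮v) v≢u

<⇒≢ʳ : ∀ {n} {u v : Fin n} → u < v → v ≢ u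
<⇒≢ʳ = ≢-sym ∘ <⇒≢

Outside : ∀ {n} → Fin n → Fin n → Fin n → Set
Outside a b z = does (a <? z) ≡ does (b <? z)

-- With c = w(m), x = w(l), y = w(k) this is κ′(α_{lm}) = κ′(α_{km}) + κ′(α_{lk}).
Additive : ∀ {n} → Fin n → Fin n → Fin n → Set
Additive c x y = δ (does (c <? x)) ≡ δ (does (c <? y)) + δ (does (y <? x))

additive-outside : ∀ {n} {a b x y : Fin n} → Outside a b x → Outside a b y →
                   Additive a x y → Additive b x y
additive-outside {x = x} {y} out-x out-y =
  subst₂ (λ u v → δ u ≡ δ v + δ (does (y <? x))) out-x out-y

outside-of-additive : ∀ {n} {a b x y : Fin n} → a < b → y ≢ b → y ≢ x →
                      Outside a b x → Additive a x y → Outside a b y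
outside-of-additive {a = a} {b} {x} {y} a<b y≢b y≢x out add
  with does (a <? y) | proof (a <? y) | does (b <? y) | proof (b <? y)
... | true  | _        | true  | _       = refl
... | false | _        | false | _       = refl
... | false | ofⁿ a≮y  | true  | ofʸ b<y = contradiction (<-trans a<b b<y) a≮y
... | true  | _        | false | ofⁿ b≮y
  with does (a <? x) | does (b <? x) | proof (b <? x) | does (y <? x) | proof (y <? x)
...   | false | _    | _       | _     | _        = contradiction add λ ()
...   | true  | false | _      | _     | _        = contradiction out λ ()
...   | true  | true | _       | true  | _        = contradiction add λ ()
...   | true  | true | ofʸ b<x | false | ofⁿ y≮x =
  contradiction (<-trans b<x (<-trans (≮∧≢⇒> y≮x (≢-sym y≢x)) (≮∧≢⇒> b≮y y≢b))) (<-irrefl refl)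

inside-not-additive : ∀ {n} {a b x y : Fin n} → a < b → y ≢ x →
                      ¬ Outside a b x → Outside a b y → ¬ Additive b x y
inside-not-additive {a = a} {b} {x} {y} a<b y≢x in-x out-y add
  with does (a <? x) | proof (a <? x) | does (b <? x) | proof (b <? x)
... | true  | _        | true  | _       = in-x refl
... | false | _        | false | _       = in-x refl
... | false | ofⁿ a≮x  | true  | ofʸ b<x = a≮x (<-trans a<b b<x)
... | true  | ofʸ a<x  | false | _
  with does (a <? y) | proof (a <? y) | does (b <? y) | does (y <? x) | proof (y <? x)
...   | _     | _       | true  | _     | _        = contradiction add λ ()
...   | _     | _       | false | true  | _        = contradiction add λ ()
...   | true  | _       | false | false | _        = contradiction out-y λ ()
...   | false | ofⁿ a≮y | false | false | ofⁿ y≮x =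
  a≮y (<-trans a<x (≮∧≢⇒> y≮x (≢-sym y≢x)))

module SetupProperties {n : ℕ} (i0 j0 : Fin n) (w : Permutation′ n) where
  open Setup i0 j0 w

  s-i0 : s i0 ≡ j0
  s-i0 rewrite dec-true (i0 ≟ i0) refl = refl

  s-j0 : s j0 ≡ i0
  s-j0 with j0 ≟ i0
  ... | yes j0≡i0 = j0≡i0
  ... | no _ rewrite dec-true (j0 ≟ j0) refl = refl

  s-fix : ∀ {z} → z ≢ i0 → z ≢ j0 → s z ≡ z
  s-fix {z} z≢i0 z≢j0 with z ≟ i0
  ... | yes z≡i0 = contradiction z≡i0 z≢i0
  ... | no _ with z ≟ j0
  ...   | yes z≡j0 = contradiction z≡j0 z≢j0
  ...   | no _ = refl

  w-injective : ∀ {u v} → u ≢ v → w ⟨$⟩ʳ u ≢ w ⟨$⟩ʳ v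
  w-injective u≢v = u≢v ∘ Injection.injective (↔⇒↣ w)

  κ′-on-column : ∀ {l m} → m ≡ i0 ⊎ m ≡ j0 → κ′ (l , m) ≡ δ (wNeg (l , m))
  κ′-on-column {l} (inj₁ refl) rewrite dec-true (i0 ≟ i0) refl | ∨-zeroʳ (does (l ≟ i0)) = refl
  κ′-on-column {l} (inj₂ refl) rewrite dec-true (j0 ≟ j0) refl
    | ∨-zeroʳ (does (j0 ≟ i0)) | ∨-zeroʳ (does (l ≟ i0)) = refl

  κ′-off-support : ∀ {l m} → l ≢ i0 → l ≢ j0 → m ≢ i0 → m ≢ j0 → κ′ (l , m) ≡ δ (wNeg (l , m))
  κ′-off-support {l} {m} l≢i0 l≢j0 m≢i0 m≢j0
    rewrite dec-false (l ≟ i0) l≢i0 | dec-false (l ≟ j0) l≢j0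
          | dec-false (m ≟ i0) m≢i0 | dec-false (m ≟ j0) m≢j0 = refl

  κ′-additive⇔ : ∀ {l m k} → m ≡ i0 ⊎ m ≡ j0 → l ≢ i0 → l ≢ j0 → k ≢ i0 → k ≢ j0 →
                 (κ′ (l , m) ≡ κ′ (k , m) + κ′ (l , k)) ⇔
                 Additive (w ⟨$⟩ʳ m) (w ⟨$⟩ʳ l) (w ⟨$⟩ʳ k)
  κ′-additive⇔ {l} {m} {k} m∈ l≢i0 l≢j0 k≢i0 k≢j0
    rewrite κ′-on-column {l} m∈ | κ′-on-column {k} m∈ | κ′-off-support l≢i0 l≢j0 k≢i0 k≢j0 = ⇔-id _

  Bad-column⇔ : ∀ {l} → j0 < l → l ≢ i0 → Bad (l , j0) ⇔ Outside (w ⟨$⟩ʳ j0) (w ⟨$⟩ʳ i0) (w ⟨$⟩ʳ l)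
  Bad-column⇔ {l} j0<l l≢i0 =
    mk⇔ (λ (_ , _ , same) → trans same w′Neg-column)
        (λ out → j0<l , inj₂ refl , trans out (sym w′Neg-column))
    where
      w′Neg-column : w′Neg (l , j0) ≡ does ((w ⟨$⟩ʳ i0) <? (w ⟨$⟩ʳ l))
      w′Neg-column = cong₂ (λ u v → does ((w ⟨$⟩ʳ u) <? (w ⟨$⟩ʳ v))) s-j0 (s-fix l≢i0 (<⇒≢ʳ j0<l))

  φ-injective-on-𝔇 : ∀ {γ p q} → InD γ p → InD γ q → φ p ≡ φ q → p ≡ q
  φ-injective-on-𝔇 (_ , _ , _ , refl , refl) (_ , _ , _ , refl , refl) φp≡φq
    with cong (proj₂ ∘ proj₂) φp≡φq
  ... | refl = refl

module ColumnRoot {n : ℕ} {i0 j0 : Fin n} {w : Permutation′ n}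
  (i0<j0 : i0 < j0) (a<b : w ⟨$⟩ʳ j0 < w ⟨$⟩ʳ i0) {l : Fin n} (j0<l : j0 < l) where
  open Setup i0 j0 w
  open SetupProperties i0 j0 w

  a b x : Fin n
  a = w ⟨$⟩ʳ j0
  b = w ⟨$⟩ʳ i0
  x = w ⟨$⟩ʳ l

  above-j0⇒≢i0 : ∀ {k} → j0 < k → k ≢ i0
  above-j0⇒≢i0 j0<k = <⇒≢ʳ (<-trans i0<j0 j0<k)

  l≢i0 : l ≢ i0
  l≢i0 = above-j0⇒≢i0 j0<l

  l≢j0 : l ≢ j0
  l≢j0 = <⇒≢ʳ j0<l

  sR-j0-column : ∀ {k} → j0 < k → sR (k , j0) ≡ (k , i0)
  sR-j0-column j0<k = cong₂ _,_ (s-fix (above-j0⇒≢i0 j0<k) (<⇒≢ʳ j0<k)) s-j0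

  sR-i0-column : ∀ {k} → j0 < k → sR (k , i0) ≡ (k , j0)
  sR-i0-column j0<k = cong₂ _,_ (s-fix (above-j0⇒≢i0 j0<k) (<⇒≢ʳ j0<k)) s-i0

  InA-sβ : ∀ {q} → InA (sR (l , j0)) q → InA (l , i0) q
  InA-sβ {q} = subst (λ γ → InA γ q) (sR-j0-column j0<l)

  bad⇔outside : Bad (l , j0) ⇔ Outside a b x
  bad⇔outside = Bad-column⇔ j0<l l≢i0

  module _ {k : Fin n} (j0<k : j0 < k) (k<l : k < l) where
    private
      k≢i0 : k ≢ i0
      k≢i0 = above-j0⇒≢i0 j0<k

      k≢j0 : k ≢ j0
      k≢j0 = <⇒≢ʳ j0<k

    y≢x : w ⟨$⟩ʳ k ≢ x
    y≢x = w-injective (<⇒≢ k<l)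

    y≢b : w ⟨$⟩ʳ k ≢ b
    y≢b = w-injective k≢i0

    κ′-additive-β⇔ : (κ′ (l , j0) ≡ κ′ (k , j0) + κ′ (l , k)) ⇔ Additive a x (w ⟨$⟩ʳ k)
    κ′-additive-β⇔ = κ′-additive⇔ (inj₂ refl) l≢i0 l≢j0 k≢i0 k≢j0

    κ′-additive-sβ⇔ : (κ′ (l , i0) ≡ κ′ (k , i0) + κ′ (l , k)) ⇔ Additive b x (w ⟨$⟩ʳ k)
    κ′-additive-sβ⇔ = κ′-additive⇔ (inj₁ refl) l≢i0 l≢j0 k≢i0 k≢j0

  bad-image⇒above-j0 : ∀ {k} → i0 < k → Bad (sR (k , i0)) → j0 < k
  bad-image⇒above-j0 {k} i0<k (j0<sk , _) with k ≟ j0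
  ... | yes k≡j0 =
    contradiction (<-trans i0<j0 (subst₂ _<_ s-i0 (trans (cong s k≡j0) s-j0) j0<sk)) (<-irrefl refl)
  ... | no k≢j0 = subst₂ _<_ s-i0 (s-fix (<⇒≢ʳ i0<k) k≢j0) j0<sk

  bad-image⇔outside : ∀ {k} → j0 < k → Bad (sR (k , i0)) ⇔ Outside a b (w ⟨$⟩ʳ k)
  bad-image⇔outside {k} j0<k =
    subst (λ γ → Bad γ ⇔ Outside a b (w ⟨$⟩ʳ k)) (sym (sR-i0-column j0<k))
      (Bad-column⇔ j0<k (above-j0⇒≢i0 j0<k))

  bad-image-index : ∀ q → InA (l , i0) q → Bad (sR (proj₁ q)) →
    ∃[ k ] (j0 < k × k < l × q ≡ ((k , i0) , (l , k))
            × Outside a b (w ⟨$⟩ʳ k) × Additive b x (w ⟨$⟩ʳ k))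
  bad-image-index _ ((k , i0<k , k<l , refl , refl) , additive) bad-q =
    k , j0<k , k<l , refl , to (bad-image⇔outside j0<k) bad-q , to (κ′-additive-sβ⇔ j0<k k<l) additive
    where
      j0<k : j0 < k
      j0<k = bad-image⇒above-j0 i0<k bad-q

  to-image : Bad (l , j0) → ∀ p → InA (l , j0) p → InA (sR (l , j0)) (φ p) × Bad (sR (proj₁ (φ p)))
  to-image bad _ ((k , j0<k , k<l , refl , refl) , additive) =
    subst₂ (λ γ γ₁ → InA γ (γ₁ , (l , k))) (sym (sR-j0-column j0<l)) (sym (sR-j0-column j0<k))
      ((k , <-trans i0<j0 j0<k , k<l , refl , refl) , from (κ′-additive-sβ⇔ j0<k k<l) additive-b) ,
    subst Bad (cong sR (sym (sR-j0-column j0<k))) (from (bad-image⇔outside j0<k) out-y)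
    where
      out-x : Outside a b x
      out-x = to bad⇔outside bad
      additive-a : Additive a x (w ⟨$⟩ʳ k)
      additive-a = to (κ′-additive-β⇔ j0<k k<l) additive
      out-y : Outside a b (w ⟨$⟩ʳ k)
      out-y = outside-of-additive a<b (y≢b j0<k k<l) (y≢x j0<k k<l) out-x additive-a
      additive-b : Additive b x (w ⟨$⟩ʳ k)
      additive-b = additive-outside {a = a} {b} {x} {w ⟨$⟩ʳ k} out-x out-y additive-a

  onto-bad-image : Bad (l , j0) → ∀ q → InA (sR (l , j0)) q → Bad (sR (proj₁ q)) →
                   ∃[ p ] (InA (l , j0) p × φ p ≡ q)
  onto-bad-image bad q q∈ bad-q with bad-image-index q (InA-sβ q∈) bad-q
  ... | k , j0<k , k<l , refl , out-y , additive-b =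
    ((k , j0) , (l , k)) ,
    ((k , j0<k , k<l , refl , refl) ,
      from (κ′-additive-β⇔ j0<k k<l)
        (additive-outside {a = b} {a} {x} {w ⟨$⟩ʳ k} (sym out-x) (sym out-y) additive-b)) ,
    cong (_, (l , k)) (sR-j0-column j0<k)
    where
      out-x : Outside a b x
      out-x = to bad⇔outside bad

  no-bad-image : ¬ Bad (l , j0) → ∀ q → InA (sR (l , j0)) q → ¬ Bad (sR (proj₁ q))
  no-bad-image ¬bad q q∈ bad-q with bad-image-index q (InA-sβ q∈) bad-q
  ... | k , j0<k , k<l , _ , out-y , additive-b =
    inside-not-additive a<b (y≢x j0<k k<l) (¬bad ∘ from bad⇔outside) out-y additive-b

lemma3p2p5 : (n : ℕ) → 3 ≤ n → (i0 j0 : Fin n) → toℕ i0 + 2 ≤ toℕ j0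
    → (w : Permutation′ n)
    → (w ⟨$⟩ʳ j0) < (w ⟨$⟩ʳ i0)
    → (∀ k → i0 < k → k < j0 → ((w ⟨$⟩ʳ j0) < (w ⟨$⟩ʳ k)) × ((w ⟨$⟩ʳ k) < (w ⟨$⟩ʳ i0)))
    → (β : Root n) → IsNeg β → Setup.SharesColα i0 j0 w β
    → (Setup.Bad i0 j0 w β
        → ((∀ p → Setup.InA i0 j0 w β p
              → Setup.InA i0 j0 w (Setup.sR i0 j0 w β) (Setup.φ i0 j0 w p)
                × Setup.Bad i0 j0 w (Setup.sR i0 j0 w (proj₁ (Setup.φ i0 j0 w p))))
          × (∀ p q → Setup.InA i0 j0 w β p → Setup.InA i0 j0 w β q
              → Setup.φ i0 j0 w p ≡ Setup.φ i0 j0 w q → p ≡ q)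
          × (∀ q → Setup.InA i0 j0 w (Setup.sR i0 j0 w β) q
              → Setup.Bad i0 j0 w (Setup.sR i0 j0 w (proj₁ q))
              → ∃[ p ] (Setup.InA i0 j0 w β p × Setup.φ i0 j0 w p ≡ q))))
      × (¬ Setup.Bad i0 j0 w β
        → ∀ q → Setup.InA i0 j0 w (Setup.sR i0 j0 w β) q
        → ¬ Setup.Bad i0 j0 w (Setup.sR i0 j0 w (proj₁ q)))
lemma3p2p5 n _ i0 j0 i0+2≤j0 w a<b _ (l , _) j0<l refl =
  (λ bad → to-image bad , (λ _ _ p∈ q∈ → φ-injective-on-𝔇 (proj₁ p∈) (proj₁ q∈)) , onto-bad-image bad) ,
  no-bad-image
  where
    i0<j0 : i0 < j0
    i0<j0 = ℕ.<-≤-trans (ℕ.m<m+n (toℕ i0) ℕ.0<1+n) i0+2≤j0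

    open ColumnRoot {w = w} i0<j0 a<b j0<l
    open SetupProperties i0 j0 w using (φ-injective-on-𝔇)
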